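{- Let $q$ be a prime power and let $\alpha$ be a primitive element of $\mathbb{F}_q$. Then there exists a set $C$ of $q^2$ distinct $2\times(q+1)$ matrices over $\mathbb{F}_q$ (an extension code) with the following properties: (1) for every matrix in $C$ with consecutive columns $v_1,v_2,\ldots,v_{q+1}$, we have $v_i=\alpha^{i-3}v_1+v_2$ for each $3\le i\le q+1$; (2) $C$ is a linear subspace of dimension $2$ over $\mathbb{F}_q$ (of the space of $2\times(q+1)$ matrices); (3) for each $i$, $1\le i\le q+1$, the $i$-th columns of the $q^2$ matrices of $C$ are pairwise distinct, i.e. they are exactly all $q^2$ column vectors in $\mathbb{F}_q^2$.
   Context: $\mathbb{F}_q$ is the finite field with $q$ elements; a primitive element of $\mathbb{F}_q$ is a generator of its multiplicative group. -}

module Defs where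

open import Level using (0ℓ)
open import Algebra.Bundles using (CommutativeRing)
open import Data.Nat using (ℕ; zero; suc; _∸_; _≤_) renaming (_*_ to _*ℕ_; _^_ to _^ℕ_)
open import Data.Nat.Primality using (Prime)
open import Data.Fin using (Fin; toℕ) renaming (zero to f0; suc to fs)
open import Data.Product using (Σ; ∃; _×_; _,_)
open import Relation.Nullary using (¬_)
open import Relation.Binary.Definitions using (Decidable)
open import Relation.Binary.PropositionalEquality using (_≡_; _≢_)

IsPrimePower : ℕ → Set
IsPrimePower q = ∃ λ p → ∃ λ k → Prime p × 1 ≤ k × q ≡ p ^ℕ k

-- Equality is assumed decidable (true of every finite field).
record FiniteField (q : ℕ) : Set₁ where
  field
    commRing : CommutativeRing 0ℓ 0ℓ
  open CommutativeRing commRing public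
  field
    0≉1       : ¬ (0# ≈ 1#)
    inverse   : ∀ x → ¬ (x ≈ 0#) → ∃ λ y → x * y ≈ 1#
    _≟_       : Decidable _≈_
    enum      : Fin q → Carrier
    enum-inj  : ∀ i j → enum i ≈ enum j → i ≡ j
    enum-surj : ∀ x → ∃ λ i → enum i ≈ x

module Over {q : ℕ} (F : FiniteField q) where
  open FiniteField F

  pow : Carrier → ℕ → Carrier
  pow a zero    = 1#
  pow a (suc n) = a * pow a n

  IsPrimitive : Carrier → Set
  IsPrimitive α = ¬ (α ≈ 0#) × (∀ x → ¬ (x ≈ 0#) → ∃ λ k → pow α k ≈ x)

  Col : Set
  Col = Fin 2 → Carrier

  _≈C_ : Col → Col → Set
  u ≈C v = ∀ r → u r ≈ v r

  -- 2 × (q+1) matrices, given by their columns v_1, …, v_{q+1}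
  -- (column j : Fin (q+1) is the column v_{toℕ j + 1})
  Mat : Set
  Mat = Fin (suc q) → Col

  _≈M_ : Mat → Mat → Set
  A ≈M B = ∀ j r → A j r ≈ B j r

  _+M_ : Mat → Mat → Mat
  (A +M B) j r = A j r + B j r

  _·M_ : Carrier → Mat → Mat
  (c ·M A) j r = c * A j r

  0M : Mat
  0M j r = 0#

  Recurrence : Carrier → Mat → Set
  Recurrence α A =
    ∀ (i₁ i₂ j : Fin (suc q)) → toℕ i₁ ≡ 0 → toℕ i₂ ≡ 1 → 2 ≤ toℕ j →
      ∀ r → A j r ≈ pow α (toℕ j ∸ 2) * A i₁ r + A i₂ r

  Code : Set
  Code = Fin (q *ℕ q) → Mat

  PairwiseDistinct : Code → Set
  PairwiseDistinct C = ∀ k l → k ≢ l → ¬ (C k ≈M C l)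

  _∈C_ : Mat → Code → Set
  A ∈C C = ∃ λ k → C k ≈M A

  TwoDimSubspace : Code → Set
  TwoDimSubspace C = ∃ λ B₁ → ∃ λ B₂ →
      (∀ a b → ((a ·M B₁) +M (b ·M B₂)) ≈M 0M → (a ≈ 0#) × (b ≈ 0#))
    × (∀ a b → ((a ·M B₁) +M (b ·M B₂)) ∈C C)
    × (∀ k → ∃ λ a → ∃ λ b → C k ≈M ((a ·M B₁) +M (b ·M B₂)))

  ColumnsAll : Code → Set
  ColumnsAll C = ∀ (j : Fin (suc q)) →
      (∀ k l → k ≢ l → ¬ (C k j ≈C C l j))
    × (∀ (v : Col) → ∃ λ k → C k j ≈C v)

-- Pick t ∈ F that is not of the form c² + c: the map x ↦ x² + x takes the
-- value 0 at both 0 and −1, so it is not injective and hence, F being finite,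
-- not surjective.  The code is the image of F² under (a, b) ↦ (v₁, …, v_{q+1})
-- with v₁ = (a, b), v₂ = (t b, a + b) and v_i = α^{i−3} v₁ + v₂.  This map is
-- linear, and every column is an invertible linear function of (a, b): for
-- i ≥ 2 it is given by the matrix [[c, t], [1, c + 1]], whose determinant
-- c² + c − t is nonzero by the choice of t.  So each column runs through F²
-- exactly once as (a, b) does.

module Submission where

open import Defs
open import Level using (0ℓ)
open import Algebra.Bundles using (CommutativeRing)
open import Algebra.Solver.Ring.AlmostCommutativeRing
  using (fromCommutativeRing; _-Raw-AlmostCommutative⟶_)
open import Data.Nat as ℕ using (ℕ; zero; suc; _≤_; _∸_; s≤s) renaming (_*_ to _*ℕ_)
open import Data.Nat.Properties using (n<1+n; +-suc)
open import Data.Integer as ℤ using (ℤ; +_; -[1+_]; _⊖_; _◃_; sign; ∣_∣)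
open import Data.Integer.Properties using ([1+m]⊖[1+n]≡m⊖n) renaming (_≟_ to _≟ℤ_)
open import Data.Sign as Sign using (Sign)
open import Data.Fin using (Fin; toℕ; punchIn; punchOut; combine; remQuot)
open import Data.Fin.Patterns using (0F; 1F)
open import Data.Fin.Properties
  using (<⇒notInjective; punchIn-punchOut; any?; all?; ¬∀⟶∃¬; remQuot-combine; combine-remQuot)
  renaming (_≟_ to _≟ᶠ_)
open import Data.Empty using (⊥-elim)
open import Data.Maybe using (Maybe; just; nothing)
open import Data.Product using (∃; _×_; _,_; proj₁; proj₂; map₂)
open import Function using (_∘_)
open import Function.Definitions using (Injective; StrictlySurjective; Congruent)
open import Relation.Nullary using (¬_; yes; no)
open import Relation.Nullary.Negation using (contradiction)
open import Relation.Binary.PropositionalEquality as ≡ using (_≡_; _≢_)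

-- The ring solver compares normal forms by computation, so its coefficients
-- need an equality test that actually computes; ℤ maps into every
-- commutative ring.
module IntegerCoefficients (R : CommutativeRing 0ℓ 0ℓ) where
  open CommutativeRing R
  open import Algebra.Properties.Ring ring using (-‿distribˡ-*; -‿distribʳ-*; -0#≈0#; -‿involutive)
  open import Algebra.Properties.AbelianGroup +-abelianGroup using (⁻¹-∙-comm; xyx⁻¹≈y)
  open import Algebra.Properties.Semiring.Mult.TCOptimised semiring
    using (1+×; ×-homo-+; ×1-homo-*) renaming (_×_ to _·_)
  open import Relation.Binary.Reasoning.Setoid setoid

  signed : Sign → Carrier → Carrier
  signed Sign.+ x = x
  signed Sign.- x = - x

  ⟦_⟧ℤ : ℤ → Carrier
  ⟦ i ⟧ℤ = signed (sign i) (∣ i ∣ · 1#)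

  signed-cong : ∀ s {x y} → x ≈ y → signed s x ≈ signed s y
  signed-cong Sign.+ x≈y = x≈y
  signed-cong Sign.- x≈y = -‿cong x≈y

  signed-* : ∀ s s′ x y → signed (s Sign.* s′) (x * y) ≈ signed s x * signed s′ y
  signed-* Sign.+ Sign.+ x y = refl
  signed-* Sign.+ Sign.- x y = -‿distribʳ-* x y
  signed-* Sign.- Sign.+ x y = -‿distribˡ-* x y
  signed-* Sign.- Sign.- x y = begin
    x * y           ≈⟨ -‿involutive (x * y) ⟨
    - (- (x * y))   ≈⟨ -‿cong (-‿distribˡ-* x y) ⟩
    - (- x * y)     ≈⟨ -‿distribʳ-* (- x) y ⟩
    - x * - y       ∎

  ⟦◃⟧ : ∀ s n → ⟦ s ◃ n ⟧ℤ ≈ signed s (n · 1#)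
  ⟦◃⟧ Sign.+ zero    = refl
  ⟦◃⟧ Sign.- zero    = sym -0#≈0#
  ⟦◃⟧ Sign.+ (suc n) = refl
  ⟦◃⟧ Sign.- (suc n) = refl

  +-‿cancelˡ : ∀ z x y → (z + x) + - (z + y) ≈ x + - y
  +-‿cancelˡ z x y = begin
    (z + x) + - (z + y)    ≈⟨ +-congˡ (⁻¹-∙-comm z y) ⟨
    (z + x) + (- z + - y)  ≈⟨ +-assoc (z + x) (- z) (- y) ⟨
    ((z + x) + - z) + - y  ≈⟨ +-congʳ (xyx⁻¹≈y z x) ⟩
    x + - y                ∎

  ⟦⊖⟧ : ∀ m n → ⟦ m ⊖ n ⟧ℤ ≈ m · 1# + - (n · 1#)
  ⟦⊖⟧ zero    zero    = sym (trans (+-identityˡ (- 0#)) -0#≈0#)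
  ⟦⊖⟧ (suc m) zero    = sym (trans (+-congˡ -0#≈0#) (+-identityʳ _))
  ⟦⊖⟧ zero    (suc n) = sym (+-identityˡ _)
  ⟦⊖⟧ (suc m) (suc n) = begin
    ⟦ suc m ⊖ suc n ⟧ℤ                  ≡⟨ ≡.cong ⟦_⟧ℤ ([1+m]⊖[1+n]≡m⊖n m n) ⟩
    ⟦ m ⊖ n ⟧ℤ                          ≈⟨ ⟦⊖⟧ m n ⟩
    m · 1# + - (n · 1#)                 ≈⟨ +-‿cancelˡ 1# (m · 1#) (n · 1#) ⟨
    (1# + m · 1#) + - (1# + n · 1#)     ≈⟨ +-cong (1+× m 1#) (-‿cong (1+× n 1#)) ⟨
    suc m · 1# + - (suc n · 1#)         ∎

  ⟦+⟧ : ∀ i j → ⟦ i ℤ.+ j ⟧ℤ ≈ ⟦ i ⟧ℤ + ⟦ j ⟧ℤ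
  ⟦+⟧ (+ m)    (+ n)    = ×-homo-+ 1# m n
  ⟦+⟧ (+ m)    -[1+ n ] = ⟦⊖⟧ m (suc n)
  ⟦+⟧ -[1+ m ] (+ n)    = trans (⟦⊖⟧ n (suc m)) (+-comm _ _)
  ⟦+⟧ -[1+ m ] -[1+ n ] = begin
    - (suc (suc (m ℕ.+ n)) · 1#)         ≡⟨ ≡.cong (λ k → - (suc k · 1#)) (+-suc m n) ⟨
    - ((suc m ℕ.+ suc n) · 1#)           ≈⟨ -‿cong (×-homo-+ 1# (suc m) (suc n)) ⟩
    - (suc m · 1# + suc n · 1#)          ≈⟨ ⁻¹-∙-comm _ _ ⟨
    - (suc m · 1#) + - (suc n · 1#)      ∎

  ⟦*⟧ : ∀ i j → ⟦ i ℤ.* j ⟧ℤ ≈ ⟦ i ⟧ℤ * ⟦ j ⟧ℤ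
  ⟦*⟧ i j = begin
    ⟦ s ◃ ∣ i ∣ ℕ.* ∣ j ∣ ⟧ℤ                    ≈⟨ ⟦◃⟧ s (∣ i ∣ ℕ.* ∣ j ∣) ⟩
    signed s ((∣ i ∣ ℕ.* ∣ j ∣) · 1#)           ≈⟨ signed-cong s (×1-homo-* ∣ i ∣ ∣ j ∣) ⟩
    signed s ((∣ i ∣ · 1#) * (∣ j ∣ · 1#))      ≈⟨ signed-* (sign i) (sign j) _ _ ⟩
    ⟦ i ⟧ℤ * ⟦ j ⟧ℤ                              ∎
    where s = sign i Sign.* sign j

  ⟦-⟧ : ∀ i → ⟦ ℤ.- i ⟧ℤ ≈ - ⟦ i ⟧ℤ
  ⟦-⟧ (+ zero)  = sym -0#≈0#
  ⟦-⟧ (+ suc n) = refl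
  ⟦-⟧ -[1+ n ]  = sym (-‿involutive _)

  ℤ⟶R : ℤ.+-*-rawRing -Raw-AlmostCommutative⟶ fromCommutativeRing R
  ℤ⟶R = record
    { ⟦_⟧ = ⟦_⟧ℤ ; +-homo = ⟦+⟧ ; *-homo = ⟦*⟧ ; -‿homo = ⟦-⟧
    ; 0-homo = refl ; 1-homo = refl }

  coefficient≟ : ∀ i j → Maybe (⟦ i ⟧ℤ ≈ ⟦ j ⟧ℤ)
  coefficient≟ i j with i ≟ℤ j
  ... | yes ≡.refl = just refl
  ... | no _       = nothing

  open import Algebra.Solver.Ring ℤ.+-*-rawRing (fromCommutativeRing R) ℤ⟶R coefficient≟ public

  :0 :1 :-1 : ∀ {n} → Polynomial n
  :0  = con (+ 0)
  :1  = con (+ 1)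
  :-1 = con -[1+ 0 ]

Fin-surjective⇒injective : ∀ {n} (f : Fin n → Fin n) →
                           StrictlySurjective _≡_ f → Injective _≡_ _≡_ f
Fin-surjective⇒injective {suc m} f surj {i} {j} fi≡fj with i ≟ᶠ j
... | yes i≡j = i≡j
... | no i≢j  = ⊥-elim (<⇒notInjective (n<1+n m) section-injective)
  where
  -- Since f i ≡ f j, every value has a preimage other than j; punching j
  -- out of these preimages gives an injection Fin (suc m) → Fin m.
  preimage : ∀ y → ∃ λ x → j ≢ x × f x ≡ y
  preimage y with surj y
  ... | x , fx≡y with j ≟ᶠ x
  ...   | no j≢x    = x , j≢x , fx≡y
  ...   | yes ≡.refl = i , i≢j ∘ ≡.sym , ≡.trans fi≡fj fx≡y

  section : Fin (suc m) → Fin m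
  section y = punchOut (proj₁ (proj₂ (preimage y)))

  f-section : ∀ y → f (punchIn j (section y)) ≡ y
  f-section y = ≡.trans (≡.cong f (punchIn-punchOut _)) (proj₂ (proj₂ (preimage y)))

  section-injective : Injective _≡_ _≡_ section
  section-injective {x} {y} sx≡sy =
    ≡.trans (≡.sym (f-section x)) (≡.trans (≡.cong (f ∘ punchIn j) sx≡sy) (f-section y))

Fin-collision⇒nonSurjective : ∀ {n} (f : Fin n → Fin n) {i j} → i ≢ j → f i ≡ f j →
                              ∃ λ y → ∀ x → f x ≢ y
Fin-collision⇒nonSurjective f i≢j fi≡fj with all? (λ y → any? λ x → f x ≟ᶠ y)
... | yes surj = contradiction (Fin-surjective⇒injective f surj fi≡fj) i≢j
... | no ¬surj = map₂ (λ ¬preimage x fx≡y → ¬preimage (x , fx≡y))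
                      (¬∀⟶∃¬ _ _ (λ y → any? λ x → f x ≟ᶠ y) ¬surj)

module Matrix₂ (R : CommutativeRing 0ℓ 0ℓ) where
  open CommutativeRing R
  open IntegerCoefficients R using (solve; :0; :1; _:=_; _:+_; _:*_; :-_)
  open import Relation.Binary.Reasoning.Setoid setoid

  Vector : Set
  Vector = Fin 2 → Carrier

  Matrix : Set
  Matrix = Fin 2 → Fin 2 → Carrier

  infix  4 _≈ᵥ_
  infixl 6 _+ᵥ_
  infixl 7 _·ᵥ_ _⊛_

  _≈ᵥ_ : Vector → Vector → Set
  u ≈ᵥ v = ∀ r → u r ≈ v r

  vec : Carrier → Carrier → Vector
  vec a b 0F = a
  vec a b 1F = b

  _+ᵥ_ : Vector → Vector → Vector
  (u +ᵥ v) r = u r + v r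

  _·ᵥ_ : Carrier → Vector → Vector
  (x ·ᵥ v) r = x * v r

  _⊛_ : Matrix → Vector → Vector
  (M ⊛ v) r = M r 0F * v 0F + M r 1F * v 1F

  identity : Matrix
  identity 0F 0F = 1#
  identity 0F 1F = 0#
  identity 1F 0F = 0#
  identity 1F 1F = 1#

  det : Matrix → Carrier
  det M = M 0F 0F * M 1F 1F + - (M 0F 1F * M 1F 0F)

  adj : Matrix → Matrix
  adj M 0F 0F = M 1F 1F
  adj M 0F 1F = - M 0F 1F
  adj M 1F 0F = - M 1F 0F
  adj M 1F 1F = M 0F 0F

  ⊛-cong : ∀ M {u v} → u ≈ᵥ v → M ⊛ u ≈ᵥ M ⊛ v
  ⊛-cong M u≈v r = +-cong (*-congˡ (u≈v 0F)) (*-congˡ (u≈v 1F))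

  identity-⊛ : ∀ v → identity ⊛ v ≈ᵥ v
  identity-⊛ v 0F = solve 2 (λ a b → :1 :* a :+ :0 :* b := a) refl (v 0F) (v 1F)
  identity-⊛ v 1F = solve 2 (λ a b → :0 :* a :+ :1 :* b := b) refl (v 0F) (v 1F)

  ⊛-linear : ∀ M a b → M ⊛ vec a b ≈ᵥ a ·ᵥ (M ⊛ vec 1# 0#) +ᵥ b ·ᵥ (M ⊛ vec 0# 1#)
  ⊛-linear M a b r = solve 4
    (λ m₀ m₁ a b → m₀ :* a :+ m₁ :* b
                := a :* (m₀ :* :1 :+ m₁ :* :0) :+ b :* (m₀ :* :0 :+ m₁ :* :1))
    refl (M r 0F) (M r 1F) a b

  ⊛-·ᵥ : ∀ M x v → M ⊛ (x ·ᵥ v) ≈ᵥ x ·ᵥ (M ⊛ v)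
  ⊛-·ᵥ M x v r = solve 5
    (λ m₀ m₁ x a b → m₀ :* (x :* a) :+ m₁ :* (x :* b) := x :* (m₀ :* a :+ m₁ :* b))
    refl (M r 0F) (M r 1F) x (v 0F) (v 1F)

  ⊛-adj-⊛ : ∀ M v → M ⊛ (adj M ⊛ v) ≈ᵥ det M ·ᵥ v
  ⊛-adj-⊛ M v 0F = solve 6
    (λ a b c d x y → a :* (d :* x :+ :- b :* y) :+ b :* (:- c :* x :+ a :* y)
                  := (a :* d :+ :- (b :* c)) :* x)
    refl (M 0F 0F) (M 0F 1F) (M 1F 0F) (M 1F 1F) (v 0F) (v 1F)
  ⊛-adj-⊛ M v 1F = solve 6
    (λ a b c d x y → c :* (d :* x :+ :- b :* y) :+ d :* (:- c :* x :+ a :* y)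
                  := (a :* d :+ :- (b :* c)) :* y)
    refl (M 0F 0F) (M 0F 1F) (M 1F 0F) (M 1F 1F) (v 0F) (v 1F)

  adj-⊛-⊛ : ∀ M v → adj M ⊛ (M ⊛ v) ≈ᵥ det M ·ᵥ v
  adj-⊛-⊛ M v 0F = solve 6
    (λ a b c d x y → d :* (a :* x :+ b :* y) :+ :- b :* (c :* x :+ d :* y)
                  := (a :* d :+ :- (b :* c)) :* x)
    refl (M 0F 0F) (M 0F 1F) (M 1F 0F) (M 1F 1F) (v 0F) (v 1F)
  adj-⊛-⊛ M v 1F = solve 6
    (λ a b c d x y → :- c :* (a :* x :+ b :* y) :+ a :* (c :* x :+ d :* y)
                  := (a :* d :+ :- (b :* c)) :* y)
    refl (M 0F 0F) (M 0F 1F) (M 1F 0F) (M 1F 1F) (v 0F) (v 1F)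

  module _ (M : Matrix) {x : Carrier} (det*x≈1 : det M * x ≈ 1#) where

    unscale : ∀ y → x * (det M * y) ≈ y
    unscale y = begin
      x * (det M * y)   ≈⟨ *-assoc x (det M) y ⟨
      x * det M * y     ≈⟨ *-congʳ (trans (*-comm x (det M)) det*x≈1) ⟩
      1# * y            ≈⟨ *-identityˡ y ⟩
      y                 ∎

    ·ᵥ-cancel : ∀ {u v} → det M ·ᵥ u ≈ᵥ det M ·ᵥ v → u ≈ᵥ v
    ·ᵥ-cancel {u} {v} du≈dv r = begin
      u r                 ≈⟨ unscale (u r) ⟨
      x * (det M * u r)   ≈⟨ *-congˡ (du≈dv r) ⟩
      x * (det M * v r)   ≈⟨ unscale (v r) ⟩
      v r                 ∎

    ⊛-injective : ∀ {u v} → M ⊛ u ≈ᵥ M ⊛ v → u ≈ᵥ v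
    ⊛-injective {u} {v} Mu≈Mv = ·ᵥ-cancel λ r → begin
      det M * u r           ≈⟨ adj-⊛-⊛ M u r ⟨
      (adj M ⊛ (M ⊛ u)) r   ≈⟨ ⊛-cong (adj M) Mu≈Mv r ⟩
      (adj M ⊛ (M ⊛ v)) r   ≈⟨ adj-⊛-⊛ M v r ⟩
      det M * v r           ∎

    ⊛-surjective : ∀ v → ∃ λ u → M ⊛ u ≈ᵥ v
    ⊛-surjective v = x ·ᵥ (adj M ⊛ v) , λ r → begin
      (M ⊛ (x ·ᵥ (adj M ⊛ v))) r   ≈⟨ ⊛-·ᵥ M x (adj M ⊛ v) r ⟩
      x * (M ⊛ (adj M ⊛ v)) r      ≈⟨ *-congˡ (⊛-adj-⊛ M v r) ⟩
      x * (det M * v r)            ≈⟨ unscale (v r) ⟩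
      v r                          ∎

module FiniteFieldProperties {q : ℕ} (F : FiniteField q) where
  open FiniteField F
  open IntegerCoefficients commRing using (solve; :0; :-1; _:=_; _:+_; _:*_)
  open import Algebra.Properties.Ring ring using (-0#≈0#; -‿involutive)

  index : Carrier → Fin q
  index x = proj₁ (enum-surj x)

  enum-index : ∀ x → enum (index x) ≈ x
  enum-index x = proj₂ (enum-surj x)

  index-cong : ∀ {x y} → x ≈ y → index x ≡ index y
  index-cong {x} {y} x≈y = enum-inj _ _ (trans (enum-index x) (trans x≈y (sym (enum-index y))))

  index-enum : ∀ i → index (enum i) ≡ i
  index-enum i = enum-inj _ _ (enum-index (enum i))

  collision⇒nonSurjective : ∀ (f : Carrier → Carrier) → Congruent _≈_ _≈_ f →
                            ∀ {x y} → ¬ x ≈ y → f x ≈ f y → ∃ λ t → ∀ c → ¬ f c ≈ t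
  collision⇒nonSurjective f f-cong {x} {y} x≉y fx≈fy =
    let s , s-missed = Fin-collision⇒nonSurjective f̂ index-distinct index-collision
    in enum s , λ c fc≈t → s-missed (index c) (begin
         index (f (enum (index c)))   ≡⟨ index-cong (f-cong (enum-index c)) ⟩
         index (f c)                  ≡⟨ index-cong fc≈t ⟩
         index (enum s)               ≡⟨ index-enum s ⟩
         s                            ∎)
    where
    open ≡.≡-Reasoning
    f̂ : Fin q → Fin q
    f̂ i = index (f (enum i))

    index-distinct : index x ≢ index y
    index-distinct ix≡iy =
      x≉y (trans (sym (enum-index x)) (trans (reflexive (≡.cong enum ix≡iy)) (enum-index y)))

    index-collision : f̂ (index x) ≡ f̂ (index y)
    index-collision =
      index-cong (trans (f-cong (enum-index x)) (trans fx≈fy (f-cong (sym (enum-index y)))))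

  -1≉0 : ¬ - 1# ≈ 0#
  -1≉0 -1≈0 = 0≉1 (begin
    0#          ≈⟨ -0#≈0# ⟨
    - 0#        ≈⟨ -‿cong -1≈0 ⟨
    - (- 1#)    ≈⟨ -‿involutive 1# ⟩
    1#          ∎)
    where open import Relation.Binary.Reasoning.Setoid setoid

  x²+x-nonSurjective : ∃ λ t → ∀ c → ¬ c * c + c ≈ t
  x²+x-nonSurjective = collision⇒nonSurjective (λ c → c * c + c)
    (λ c≈d → +-cong (*-cong c≈d c≈d) c≈d) -1≉0
    (solve 0 (:-1 :* :-1 :+ :-1 := :0 :* :0 :+ :0) refl)

module ExtensionCode {q : ℕ} (F : FiniteField q) (α : FiniteField.Carrier F) where
  open FiniteField F
  open Over F
  open Matrix₂ commRing
  open FiniteFieldProperties F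
  open IntegerCoefficients commRing using (solve; :0; :1; _:=_; _:+_; _:*_; :-_)
  open import Relation.Binary.Reasoning.Setoid setoid

  t : Carrier
  t = proj₁ x²+x-nonSurjective

  companion : Carrier → Matrix
  companion c 0F 0F = c
  companion c 0F 1F = t
  companion c 1F 0F = 1#
  companion c 1F 1F = c + 1#

  companion-split : ∀ c v → companion c ⊛ v ≈ᵥ c ·ᵥ (identity ⊛ v) +ᵥ companion 0# ⊛ v
  companion-split c v 0F = solve 4
    (λ c t a b → c :* a :+ t :* b
              := c :* (:1 :* a :+ :0 :* b) :+ (:0 :* a :+ t :* b))
    refl c t (v 0F) (v 1F)
  companion-split c v 1F = solve 3
    (λ c a b → :1 :* a :+ (c :+ :1) :* b
            := c :* (:0 :* a :+ :1 :* b) :+ (:1 :* a :+ (:0 :+ :1) :* b))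
    refl c (v 0F) (v 1F)

  companion-det≉0 : ∀ c → ¬ det (companion c) ≈ 0#
  companion-det≉0 c det≈0 = proj₂ x²+x-nonSurjective c (begin
    c * c + c               ≈⟨ solve 2 (λ c t → c :* c :+ c
                                         := (c :* (c :+ :1) :+ :- (t :* :1)) :+ t)
                                 refl c t ⟩
    det (companion c) + t   ≈⟨ +-congʳ det≈0 ⟩
    0# + t                  ≈⟨ +-identityˡ t ⟩
    t                       ∎)

  identity-det≉0 : ¬ det identity ≈ 0#
  identity-det≉0 det≈0 = 0≉1 (begin
    0#               ≈⟨ det≈0 ⟨
    det identity     ≈⟨ solve 0 (:1 :* :1 :+ :- (:0 :* :0) := :1) refl ⟩
    1#               ∎)

  columnMatrix : ℕ → Matrix
  columnMatrix zero          = identity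
  columnMatrix (suc zero)    = companion 0#
  columnMatrix (suc (suc m)) = companion (pow α m)

  columnMatrix-det≉0 : ∀ n → ¬ det (columnMatrix n) ≈ 0#
  columnMatrix-det≉0 zero          = identity-det≉0
  columnMatrix-det≉0 (suc zero)    = companion-det≉0 0#
  columnMatrix-det≉0 (suc (suc m)) = companion-det≉0 (pow α m)

  columnMatrix-injective : ∀ n {u v} → columnMatrix n ⊛ u ≈ᵥ columnMatrix n ⊛ v → u ≈ᵥ v
  columnMatrix-injective n =
    ⊛-injective (columnMatrix n) (proj₂ (inverse _ (columnMatrix-det≉0 n)))

  columnMatrix-surjective : ∀ n v → ∃ λ u → columnMatrix n ⊛ u ≈ᵥ v
  columnMatrix-surjective n =
    ⊛-surjective (columnMatrix n) (proj₂ (inverse _ (columnMatrix-det≉0 n)))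

  encode : Vector → Mat
  encode v j = columnMatrix (toℕ j) ⊛ v

  encode-cong : ∀ {u v} → u ≈ᵥ v → encode u ≈M encode v
  encode-cong u≈v j = ⊛-cong (columnMatrix (toℕ j)) u≈v

  encode-recurrence : ∀ v → Recurrence α (encode v)
  encode-recurrence v i₁ i₂ j = columns (toℕ i₁) (toℕ i₂) (toℕ j)
    where
    columns : ∀ n₁ n₂ n → n₁ ≡ 0 → n₂ ≡ 1 → 2 ≤ n → ∀ r →
              (columnMatrix n ⊛ v) r
                ≈ pow α (n ∸ 2) * (columnMatrix n₁ ⊛ v) r + (columnMatrix n₂ ⊛ v) r
    columns .0 .1 (suc (suc m)) ≡.refl ≡.refl (s≤s (s≤s _)) = companion-split (pow α m) v

  basis₁ basis₂ : Mat
  basis₁ = encode (vec 1# 0#)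
  basis₂ = encode (vec 0# 1#)

  encode-linear : ∀ a b → encode (vec a b) ≈M ((a ·M basis₁) +M (b ·M basis₂))
  encode-linear a b j = ⊛-linear (columnMatrix (toℕ j)) a b

  basis-independent : ∀ a b → ((a ·M basis₁) +M (b ·M basis₂)) ≈M 0M → (a ≈ 0#) × (b ≈ 0#)
  basis-independent a b combination≈0 = coordinate 0F , coordinate 1F
    where
    coordinate : ∀ r → vec a b r ≈ 0#
    coordinate r = begin
      vec a b r                                   ≈⟨ identity-⊛ (vec a b) r ⟨
      encode (vec a b) 0F r                       ≈⟨ encode-linear a b 0F r ⟩
      ((a ·M basis₁) +M (b ·M basis₂)) 0F r       ≈⟨ combination≈0 0F r ⟩
      0#                                          ∎

  -- A codeword is indexed by the base-q digits of its first column.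
  coordinates : Fin (q *ℕ q) → Vector
  coordinates k = let i , j = remQuot q k in vec (enum i) (enum j)

  coordinates-injective : ∀ {k l} → coordinates k ≈ᵥ coordinates l → k ≡ l
  coordinates-injective {k} {l} ck≈cl =
    ≡.trans (≡.sym (combine-remQuot {q} q k))
      (≡.trans (≡.cong₂ combine (enum-inj _ _ (ck≈cl 0F)) (enum-inj _ _ (ck≈cl 1F)))
        (combine-remQuot {q} q l))

  coordinates-surjective : ∀ v → ∃ λ k → coordinates k ≈ᵥ v
  coordinates-surjective v = combine i j , λ r → begin
      coordinates (combine i j) r
        ≡⟨ ≡.cong (λ (i , j) → vec (enum i) (enum j) r) (remQuot-combine i j) ⟩
      vec (enum i) (enum j) r       ≈⟨ enum-vec r ⟩
      v r                           ∎
    where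
    i j : Fin q
    i = index (v 0F)
    j = index (v 1F)
    enum-vec : vec (enum i) (enum j) ≈ᵥ v
    enum-vec 0F = enum-index (v 0F)
    enum-vec 1F = enum-index (v 1F)

  code : Code
  code k = encode (coordinates k)

  columnsAll : ColumnsAll code
  columnsAll j = distinct , exhaustive
    where
    distinct : ∀ k l → k ≢ l → ¬ code k j ≈C code l j
    distinct k l k≢l = k≢l ∘ coordinates-injective ∘ columnMatrix-injective (toℕ j)

    exhaustive : ∀ v → ∃ λ k → code k j ≈C v
    exhaustive v =
      let u , Mu≈v = columnMatrix-surjective (toℕ j) v
          k , ck≈u = coordinates-surjective u
      in k , λ r → trans (encode-cong ck≈u j r) (Mu≈v r)

  pairwiseDistinct : PairwiseDistinct code
  pairwiseDistinct k l k≢l ck≈cl = proj₁ (columnsAll 0F) k l k≢l (ck≈cl 0F)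

  twoDimSubspace : TwoDimSubspace code
  twoDimSubspace = basis₁ , basis₂ , basis-independent , spanned , spanning
    where
    spanned : ∀ a b → ((a ·M basis₁) +M (b ·M basis₂)) ∈C code
    spanned a b =
      let k , ck≈ab = coordinates-surjective (vec a b)
      in k , λ j r → trans (encode-cong ck≈ab j r) (encode-linear a b j r)

    spanning : ∀ k → ∃ λ a → ∃ λ b → code k ≈M ((a ·M basis₁) +M (b ·M basis₂))
    spanning k = a , b , encode-linear a b
      where
      a b : Carrier
      a = coordinates k 0F
      b = coordinates k 1F

lemma4 : (q : ℕ) → IsPrimePower q → (F : FiniteField q) →
    (α : FiniteField.Carrier F) → Over.IsPrimitive F α →
    ∃ λ (C : Over.Code F) →
    Over.PairwiseDistinct F C
    × (∀ k → Over.Recurrence F α (C k))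
    × Over.TwoDimSubspace F C
    × Over.ColumnsAll F C
lemma4 q _ F α _ =
  code , pairwiseDistinct , encode-recurrence ∘ coordinates , twoDimSubspace , columnsAll
  where open ExtensionCode F α
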